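{- Let $G=(V,E)$ be a finite directed graph and let $(S_1^{\ast},S_2^{\ast})$ be a pair of nonempty subsets of $V$ maximizing $\mathrm{d}(S_1,S_2)=|E(S_1,S_2)|/\sqrt{|S_1||S_2|}$. Let $\epsilon_1,\epsilon_2\ge 0$ and let $S_1,S_2\subseteq V$ satisfy, for $i=1,2$, $|S_i\cap S_i^{\ast}|\ge(1-\epsilon_i)|S_i^{\ast}|$ and $|S_i\setminus S_i^{\ast}|\le \epsilon_i|S_i^{\ast}|$. Let $S_i'=S_i^{\ast}\setminus S_i$ for $i=1,2$. Then $|E(S_1',S_2')|\le \sqrt{\epsilon_1\epsilon_2}\,|E(S_1^{\ast},S_2^{\ast})|$.
   Context: For $A,B\subseteq V$ (not necessarily disjoint), $E(A,B)$ denotes the set of directed edges $u\to v$ of $G$ with $u\in A$ and $v\in B$.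
   Formalization: The parameters ε₁ and ε₂ range over the nonnegative rationals. -}

module Defs where

open import Data.Bool using (Bool; true; false; _∧_; if_then_else_)
open import Data.Nat using (ℕ; _+_; _*_; _≤_)
open import Data.Fin using (Fin)
open import Data.List using (List; map; allFin)
open import Data.Nat.ListAction using (sum)
open import Data.Vec using (lookup)
open import Data.Fin.Subset using (Subset; Side; inside; outside; ∣_∣; Nonempty)
open import Data.Integer using (+_)
open import Data.Rational using (ℚ; _/_)

Digraph : ℕ → Set
Digraph n = Fin n → Fin n → Bool

inSide : Side → Bool
inSide inside  = true
inSide outside = false

eCount : ∀ {n} → Digraph n → Subset n → Subset n → ℕ
eCount {n} G A B =
  sum (map (λ u → sum (map (λ v →
    if inSide (lookup A u) ∧ inSide (lookup B v) ∧ G u v then 1 else 0)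
    (allFin n))) (allFin n))

-- d(T₁,T₂) ≤ d(S₁,S₂), where d(A,B) = |E(A,B)| / sqrt(|A||B|), for nonempty
-- sets; written out with both (nonnegative) sides squared and denominators cleared:
-- |E(T₁,T₂)|² · |S₁||S₂| ≤ |E(S₁,S₂)|² · |T₁||T₂|.
density≤ : ∀ {n} → Digraph n → Subset n → Subset n → Subset n → Subset n → Set
density≤ G T₁ T₂ S₁ S₂ =
  eCount G T₁ T₂ * eCount G T₁ T₂ * (∣ S₁ ∣ * ∣ S₂ ∣)
    ≤ eCount G S₁ S₂ * eCount G S₁ S₂ * (∣ T₁ ∣ * ∣ T₂ ∣)

IsDensestPair : ∀ {n} → Digraph n → Subset n → Subset n → Set
IsDensestPair {n} G S₁ S₂ =
  Nonempty S₁ × Nonempty S₂ ×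
  ((T₁ T₂ : Subset n) → Nonempty T₁ → Nonempty T₂ → density≤ G T₁ T₂ S₁ S₂)
  where open import Data.Product using (_×_)

ℕ→ℚ : ℕ → ℚ
ℕ→ℚ k = + k / 1

{-# OPTIONS --safe #-}
-- Since (S₁*,S₂*) is densest, the pair S₁' = S₁* ─ S₁, S₂' = S₂* ─ S₂ is no denser
-- (trivially so if one of them is empty, for then it spans no edge):
-- |E(S₁',S₂')|² |S₁*||S₂*| ≤ |E(S₁*,S₂*)|² |S₁'||S₂'|.  Because S₁' and S₁ ∩ S₁* partition
-- S₁*, the lower bound on |S₁ ∩ S₁*| gives |S₁'| ≤ ε₁|S₁*|, likewise |S₂'| ≤ ε₂|S₂*|,
-- and cancelling |S₁*||S₂*| > 0 leaves |E(S₁',S₂')|² ≤ ε₁ε₂ |E(S₁*,S₂*)|².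
module Submission where

open import Defs
open import Data.Nat using (ℕ)
open import Data.Fin.Subset using (Subset; _∩_; _─_; ∣_∣)
open import Data.Rational using (ℚ; _≤_; _*_; _-_; 0ℚ; 1ℚ)

open import Data.Bool using (_∧_; if_then_else_)
open import Data.Bool.Properties using (∧-zeroʳ)
open import Data.Fin using (suc)
open import Data.Fin.Subset using (inside; outside; ⊥; Nonempty; Empty)
open import Data.Fin.Subset.Properties using (nonempty?; Empty-unique)
open import Data.Integer using (+_)
import Data.Integer as ℤ
import Data.Integer.Properties as ℤ
open import Data.List using ([]; _∷_; map; allFin)
open import Data.Nat.ListAction using (sum)
import Data.Nat as ℕ
import Data.Nat.Properties as ℕ
open import Data.Nat.Coprimality using (1-coprimeTo) renaming (sym to coprime-sym)
open import Data.Product using (_,_)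
open import Data.Rational using (*≤*; mkℚ; _+_; Positive; NonNegative; nonNegative)
open import Data.Rational.Properties
open import Data.Rational.Solver using (module +-*-Solver)
import Data.Rational.Unnormalised as ℚᵘ
import Data.Rational.Unnormalised.Properties as ℚᵘ
open import Data.Vec using ([]; _∷_; lookup; there)
open import Data.Vec.Properties using (lookup-replicate)
open import Relation.Nullary using (yes; no)
open import Relation.Binary.PropositionalEquality

-- ℕ→ℚ k = normalize k 1 is stuck on a gcd for variable k; its normal form computes.
mkℚ-ℕ : ℕ → ℚ
mkℚ-ℕ k = mkℚ (+ k) 0 (coprime-sym (1-coprimeTo k))

ℕ→ℚ≡mkℚ : ∀ k → ℕ→ℚ k ≡ mkℚ-ℕ k
ℕ→ℚ≡mkℚ k = normalize-coprime (coprime-sym (1-coprimeTo k))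

ℕ→ℚ-mono-≤ : ∀ {a b} → a ℕ.≤ b → ℕ→ℚ a ≤ ℕ→ℚ b
ℕ→ℚ-mono-≤ {a} {b} a≤b rewrite ℕ→ℚ≡mkℚ a | ℕ→ℚ≡mkℚ b =
  *≤* (subst₂ ℤ._≤_ (sym (ℤ.*-identityʳ (+ a))) (sym (ℤ.*-identityʳ (+ b))) (ℤ.+≤+ a≤b))

ℕ→ℚ-homo-+ : ∀ a b → ℕ→ℚ (a ℕ.+ b) ≡ ℕ→ℚ a + ℕ→ℚ b
ℕ→ℚ-homo-+ a b rewrite ℕ→ℚ≡mkℚ (a ℕ.+ b) | ℕ→ℚ≡mkℚ a | ℕ→ℚ≡mkℚ b =
  toℚᵘ-injective (ℚᵘ.≃-trans (ℚᵘ.*≡* (cong (ℤ._* + 1) numerators))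
                             (ℚᵘ.≃-sym (toℚᵘ-homo-+ (mkℚ-ℕ a) (mkℚ-ℕ b))))
  where
  numerators : + (a ℕ.+ b) ≡ (+ a ℤ.* + 1) ℤ.+ (+ b ℤ.* + 1)
  numerators rewrite ℤ.*-identityʳ (+ a) | ℤ.*-identityʳ (+ b) = ℤ.pos-+ a b

ℕ→ℚ-homo-* : ∀ a b → ℕ→ℚ (a ℕ.* b) ≡ ℕ→ℚ a * ℕ→ℚ b
ℕ→ℚ-homo-* a b rewrite ℕ→ℚ≡mkℚ (a ℕ.* b) | ℕ→ℚ≡mkℚ a | ℕ→ℚ≡mkℚ b =
  toℚᵘ-injective (ℚᵘ.≃-trans (ℚᵘ.*≡* (cong (ℤ._* + 1) (ℤ.pos-* a b)))
                             (ℚᵘ.≃-sym (toℚᵘ-homo-* (mkℚ-ℕ a) (mkℚ-ℕ b))))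

ℕ→ℚ-nonNeg : ∀ k → NonNegative (ℕ→ℚ k)
ℕ→ℚ-nonNeg k = normalize-nonNeg k 1

ℕ→ℚ-pos : ∀ k .{{_ : ℕ.NonZero k}} → Positive (ℕ→ℚ k)
ℕ→ℚ-pos k = normalize-pos k 1

open +-*-Solver
open ≤-Reasoning

≤-complement : ∀ {ε c a s} → c + a ≡ s → (1ℚ - ε) * s ≤ c → a ≤ ε * s
≤-complement {ε} {c} {a} {s} c+a≡s core = begin
  a                                  ≡⟨ solve 3 (λ e A S → A := ((con 1ℚ :- e) :* S :+ A) :+ (e :* S :- S)) refl ε a s ⟩
  ((1ℚ - ε) * s + a) + (ε * s - s)   ≤⟨ +-monoˡ-≤ (ε * s - s) (+-monoˡ-≤ a core) ⟩
  (c + a) + (ε * s - s)              ≡⟨ cong (_+ (ε * s - s)) c+a≡s ⟩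
  s + (ε * s - s)                    ≡⟨ solve 2 (λ e S → S :+ (e :* S :- S) := e :* S) refl ε s ⟩
  ε * s                              ∎

≤-scaled-* : ∀ {a b} ε δ s t .{{_ : NonNegative a}} .{{_ : NonNegative b}} →
             a ≤ ε * s → b ≤ δ * t → a * b ≤ (ε * δ) * (s * t)
≤-scaled-* {a} {b} ε δ s t a≤εs b≤δt = begin
  a * b               ≤⟨ *-monoʳ-≤-nonNeg b a≤εs ⟩
  (ε * s) * b         ≤⟨ *-monoˡ-≤-nonNeg (ε * s) {{εs-nonNeg}} b≤δt ⟩
  (ε * s) * (δ * t)   ≡⟨ solve 4 (λ e d S T → (e :* S) :* (d :* T) := (e :* d) :* (S :* T)) refl ε δ s t ⟩
  (ε * δ) * (s * t)   ∎
  where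
  εs-nonNeg : NonNegative (ε * s)
  εs-nonNeg = nonNegative (≤-trans (nonNegative⁻¹ a) a≤εs)

≤-from-ratio : ∀ x y s a ε .{{_ : Positive s}} .{{_ : NonNegative y}} →
              x * s ≤ y * a → a ≤ ε * s → x ≤ ε * y
≤-from-ratio x y s a ε xs≤ya a≤εs = *-cancelʳ-≤-pos s (begin
  x * s         ≤⟨ xs≤ya ⟩
  y * a         ≤⟨ *-monoˡ-≤-nonNeg y a≤εs ⟩
  y * (ε * s)   ≡⟨ solve 3 (λ Y e S → Y :* (e :* S) := (e :* Y) :* S) refl y ε s ⟩
  (ε * y) * s   ∎)

∣p∩q∣+∣q─p∣≡∣q∣ : ∀ {n} (p q : Subset n) → ∣ p ∩ q ∣ ℕ.+ ∣ q ─ p ∣ ≡ ∣ q ∣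
∣p∩q∣+∣q─p∣≡∣q∣ []            []            = refl
∣p∩q∣+∣q─p∣≡∣q∣ (inside  ∷ p) (inside  ∷ q) = cong ℕ.suc (∣p∩q∣+∣q─p∣≡∣q∣ p q)
∣p∩q∣+∣q─p∣≡∣q∣ (outside ∷ p) (inside  ∷ q) = trans (ℕ.+-suc _ _) (cong ℕ.suc (∣p∩q∣+∣q─p∣≡∣q∣ p q))
∣p∩q∣+∣q─p∣≡∣q∣ (inside  ∷ p) (outside ∷ q) = ∣p∩q∣+∣q─p∣≡∣q∣ p q
∣p∩q∣+∣q─p∣≡∣q∣ (outside ∷ p) (outside ∷ q) = ∣p∩q∣+∣q─p∣≡∣q∣ p q

nonempty⇒∣p∣>0 : ∀ {n} {p : Subset n} → Nonempty p → ∣ p ∣ ℕ.> 0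
nonempty⇒∣p∣>0 {p = inside  ∷ p} _                  = ℕ.s≤s ℕ.z≤n
nonempty⇒∣p∣>0 {p = outside ∷ p} (suc x , there x∈p) = nonempty⇒∣p∣>0 (x , x∈p)

sum-map-≡0 : ∀ {A : Set} {f : A → ℕ} → (∀ x → f x ≡ 0) → ∀ xs → sum (map f xs) ≡ 0
sum-map-≡0 f≡0 []       = refl
sum-map-≡0 f≡0 (x ∷ xs) rewrite f≡0 x = sum-map-≡0 f≡0 xs

eCount-emptyˡ : ∀ {n} (G : Digraph n) {A : Subset n} (B : Subset n) → Empty A → eCount G A B ≡ 0
eCount-emptyˡ {n} G B A-empty rewrite Empty-unique A-empty =
  sum-map-≡0 (λ u → sum-map-≡0 (λ v → no-edge u v) (allFin n)) (allFin n)
  where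
  no-edge : ∀ u v → (if inSide (lookup ⊥ u) ∧ inSide (lookup B v) ∧ G u v then 1 else 0) ≡ 0
  no-edge u v rewrite lookup-replicate u outside = refl

eCount-emptyʳ : ∀ {n} (G : Digraph n) (A : Subset n) {B : Subset n} → Empty B → eCount G A B ≡ 0
eCount-emptyʳ {n} G A B-empty rewrite Empty-unique B-empty =
  sum-map-≡0 (λ u → sum-map-≡0 (λ v → no-edge u v) (allFin n)) (allFin n)
  where
  no-edge : ∀ u v → (if inSide (lookup A u) ∧ inSide (lookup ⊥ v) ∧ G u v then 1 else 0) ≡ 0
  no-edge u v rewrite lookup-replicate v outside | ∧-zeroʳ (inSide (lookup A u)) = refl

density≤-edgeless : ∀ {n} (G : Digraph n) (T₁ T₂ S₁ S₂ : Subset n) →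
                    eCount G T₁ T₂ ≡ 0 → density≤ G T₁ T₂ S₁ S₂
density≤-edgeless G T₁ T₂ S₁ S₂ e≡0 rewrite e≡0 = ℕ.z≤n

IsDensestPair⇒density≤ : ∀ {n} {G : Digraph n} {S₁ S₂ : Subset n} → IsDensestPair G S₁ S₂ →
                         ∀ T₁ T₂ → density≤ G T₁ T₂ S₁ S₂
IsDensestPair⇒density≤ {G = G} {S₁} {S₂} (_ , _ , densest) T₁ T₂ with nonempty? T₁ | nonempty? T₂
... | yes ne₁ | yes ne₂ = densest T₁ T₂ ne₁ ne₂
... | no  e₁  | _       = density≤-edgeless G T₁ T₂ S₁ S₂ (eCount-emptyˡ G T₂ e₁)
... | yes _   | no  e₂  = density≤-edgeless G T₁ T₂ S₁ S₂ (eCount-emptyʳ G T₁ e₂)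

ℕ→ℚ-sq* : ∀ a b c → ℕ→ℚ (a ℕ.* a ℕ.* (b ℕ.* c)) ≡ ℕ→ℚ a * ℕ→ℚ a * (ℕ→ℚ b * ℕ→ℚ c)
ℕ→ℚ-sq* a b c = trans (ℕ→ℚ-homo-* (a ℕ.* a) (b ℕ.* c))
                      (cong₂ _*_ (ℕ→ℚ-homo-* a a) (ℕ→ℚ-homo-* b c))

∣q─p∣≤ε∣q∣ : ∀ {n} ε (p q : Subset n) → (1ℚ - ε) * ℕ→ℚ ∣ q ∣ ≤ ℕ→ℚ ∣ p ∩ q ∣ →
             ℕ→ℚ ∣ q ─ p ∣ ≤ ε * ℕ→ℚ ∣ q ∣
∣q─p∣≤ε∣q∣ ε p q = ≤-complement {ε}
  (trans (sym (ℕ→ℚ-homo-+ ∣ p ∩ q ∣ ∣ q ─ p ∣)) (cong ℕ→ℚ (∣p∩q∣+∣q─p∣≡∣q∣ p q)))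

proposition2 : ∀ {n : ℕ} (G : Digraph n) (S₁* S₂* : Subset n) →
    IsDensestPair G S₁* S₂* →
    (ε₁ ε₂ : ℚ) → 0ℚ ≤ ε₁ → 0ℚ ≤ ε₂ →
    (S₁ S₂ : Subset n) →
    (1ℚ - ε₁) * ℕ→ℚ ∣ S₁* ∣ ≤ ℕ→ℚ ∣ S₁ ∩ S₁* ∣ →
    ℕ→ℚ ∣ S₁ ─ S₁* ∣ ≤ ε₁ * ℕ→ℚ ∣ S₁* ∣ →
    (1ℚ - ε₂) * ℕ→ℚ ∣ S₂* ∣ ≤ ℕ→ℚ ∣ S₂ ∩ S₂* ∣ →
    ℕ→ℚ ∣ S₂ ─ S₂* ∣ ≤ ε₂ * ℕ→ℚ ∣ S₂* ∣ →
    -- conclusion |E(S₁',S₂')| ≤ √(ε₁ε₂) |E(S₁*,S₂*)|, squared (both sides ≥ 0)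
    ℕ→ℚ (eCount G (S₁* ─ S₁) (S₂* ─ S₂)) * ℕ→ℚ (eCount G (S₁* ─ S₁) (S₂* ─ S₂))
      ≤ (ε₁ * ε₂) * (ℕ→ℚ (eCount G S₁* S₂*) * ℕ→ℚ (eCount G S₁* S₂*))
proposition2 G S₁* S₂* densest@(ne₁ , ne₂ , _) ε₁ ε₂ _ _ S₁ S₂ kept₁ _ kept₂ _ =
  ≤-from-ratio (E′ * E′) (E * E) (s₁ * s₂) (r₁ * r₂) (ε₁ * ε₂) density
    (≤-scaled-* ε₁ ε₂ s₁ s₂ (∣q─p∣≤ε∣q∣ ε₁ S₁ S₁* kept₁) (∣q─p∣≤ε∣q∣ ε₂ S₂ S₂* kept₂))
  where
  e′ e : ℕ
  e′ = eCount G (S₁* ─ S₁) (S₂* ─ S₂)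
  e  = eCount G S₁* S₂*

  E′ E s₁ s₂ r₁ r₂ : ℚ
  E′ = ℕ→ℚ e′
  E  = ℕ→ℚ e
  s₁ = ℕ→ℚ ∣ S₁* ∣
  s₂ = ℕ→ℚ ∣ S₂* ∣
  r₁ = ℕ→ℚ ∣ S₁* ─ S₁ ∣
  r₂ = ℕ→ℚ ∣ S₂* ─ S₂ ∣

  density : E′ * E′ * (s₁ * s₂) ≤ E * E * (r₁ * r₂)
  density = subst₂ _≤_ (ℕ→ℚ-sq* e′ ∣ S₁* ∣ ∣ S₂* ∣) (ℕ→ℚ-sq* e ∣ S₁* ─ S₁ ∣ ∣ S₂* ─ S₂ ∣)
                   (ℕ→ℚ-mono-≤ (IsDensestPair⇒density≤ densest (S₁* ─ S₁) (S₂* ─ S₂)))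

  instance
    s₁s₂-pos : Positive (s₁ * s₂)
    s₁s₂-pos = pos*pos⇒pos s₁ {{ℕ→ℚ-pos _ {{ℕ.>-nonZero (nonempty⇒∣p∣>0 ne₁)}}}}
                           s₂ {{ℕ→ℚ-pos _ {{ℕ.>-nonZero (nonempty⇒∣p∣>0 ne₂)}}}}
    E²-nonNeg : NonNegative (E * E)
    E²-nonNeg = nonNeg*nonNeg⇒nonNeg E {{ℕ→ℚ-nonNeg e}} E {{ℕ→ℚ-nonNeg e}}
    r₁-nonNeg : NonNegative r₁
    r₁-nonNeg = ℕ→ℚ-nonNeg ∣ S₁* ─ S₁ ∣
    r₂-nonNeg : NonNegative r₂
    r₂-nonNeg = ℕ→ℚ-nonNeg ∣ S₂* ─ S₂ ∣
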